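{- Let $(d^S_0,\mathscr{E}^S,d^S_1)$ with $d^S_0:\mathscr{E}^S\to\mathscr{C}$, $d^S_1:\mathscr{E}^S\to\mathscr{B}$ and $(d^R_0,\mathscr{E}^R,d^R_1)$ with $d^R_0:\mathscr{E}^R\to\mathscr{B}$, $d^R_1:\mathscr{E}^R\to\mathscr{A}$ be two-sided discrete fibrations of preorders. Let $\mathscr{E}^S\circ\mathscr{E}^R=\{(e,f)\in\mathscr{E}^S\times\mathscr{E}^R: d^S_1(e)=d^R_0(f)\}$ (componentwise order) with projections $q_0:\mathscr{E}^S\circ\mathscr{E}^R\to\mathscr{E}^S$, $q_1:\mathscr{E}^S\circ\mathscr{E}^R\to\mathscr{E}^R$. Then the pullback square $d^S_1\circ q_0=d^R_0\circ q_1$, regarded as a lax square with identity comparison, is exact; i.e. for all $e\in\mathscr{E}^S$, $f\in\mathscr{E}^R$, $$\mathscr{B}(d^S_1 e,\,d^R_0 f)=\bigvee_{w\in\mathscr{E}^S\circ\mathscr{E}^R}\mathscr{E}^S(e,q_0w)\wedge\mathscr{E}^R(q_1w,f).$$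
   Context: $\mathscr{X}(x,x')\in\{0,1\}$ is the truth value of $x\le x'$ in a preorder $\mathscr{X}$. A lax square of monotone maps $p_0:\mathscr{P}\to\mathscr{X}$, $p_1:\mathscr{P}\to\mathscr{Y}$, $f:\mathscr{X}\to\mathscr{Z}$, $g:\mathscr{Y}\to\mathscr{Z}$ with $f(p_0w)\le g(p_1w)$ for all $w$ is exact iff for all $x,y$: $\mathscr{Z}(fx,gy)=\bigvee_w \mathscr{X}(x,p_0w)\wedge\mathscr{Y}(p_1w,y)$. A span $(d_0,\mathscr{E},d_1)$ ($d_0:\mathscr{E}\to\mathscr{X}$, $d_1:\mathscr{E}\to\mathscr{Y}$ monotone) is a two-sided discrete fibration if: (1) for every $e'$ and $x\le d_0(e')$ there is a unique $e$ with $d_0(e)=x$, $d_1(e)=d_1(e')$, $e\le e'$ (call it $(d_0)_*(e')$); (2) for every $e$ and $d_1(e)\le y'$ there is a unique $e''$ with $d_0(e'')=d_0(e)$, $d_1(e'')=y'$, $e\le e''$ (call it $(d_1)_*(e)$); (3) whenever $e\le e'$, $(d_1)_*(e)$ (for $d_1(e)\le d_1(e')$) equals $(d_0)_*(e')$ (for $d_0(e)\le d_0(e')$). -}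

module Defs where

open import Data.Product using (Σ; _×_; _,_; proj₁; proj₂)
open import Relation.Binary.PropositionalEquality using (_≡_)

-- A preorder: a set with a reflexive, transitive relation
-- (x ≤ x' inhabited  <->  the truth value 𝒳(x,x') is 1).
record Preord : Set₁ where
  field
    Carrier : Set
    _≤_     : Carrier → Carrier → Set
    refl    : ∀ {x} → x ≤ x
    trans   : ∀ {x y z} → x ≤ y → y ≤ z → x ≤ z

open Preord public

record Mono (X Y : Preord) : Set where
  field
    fun  : Carrier X → Carrier Y
    mono : ∀ {x x'} → _≤_ X x x' → _≤_ Y (fun x) (fun x')

open Mono public

-- The unique lifts of (1) and (2) are recorded as
-- functions (lift₀ = (d₀)_*, lift₁ = (d₁)_*) together with their
-- defining properties and uniqueness; (3) is the compatibility condition.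
record IsTwoSidedDiscFib {X Y E : Preord} (d₀ : Mono E X) (d₁ : Mono E Y) : Set where
  field
    lift₀      : (e' : Carrier E) (x : Carrier X) → _≤_ X x (fun d₀ e') → Carrier E
    lift₀-d₀   : ∀ e' x p → fun d₀ (lift₀ e' x p) ≡ x
    lift₀-d₁   : ∀ e' x p → fun d₁ (lift₀ e' x p) ≡ fun d₁ e'
    lift₀-≤    : ∀ e' x p → _≤_ E (lift₀ e' x p) e'
    lift₀-uniq : ∀ e' x p (e : Carrier E) → fun d₀ e ≡ x → fun d₁ e ≡ fun d₁ e'
                 → _≤_ E e e' → e ≡ lift₀ e' x p
    lift₁      : (e : Carrier E) (y' : Carrier Y) → _≤_ Y (fun d₁ e) y' → Carrier E
    lift₁-d₀   : ∀ e y' p → fun d₀ (lift₁ e y' p) ≡ fun d₀ e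
    lift₁-d₁   : ∀ e y' p → fun d₁ (lift₁ e y' p) ≡ y'
    lift₁-≤    : ∀ e y' p → _≤_ E e (lift₁ e y' p)
    lift₁-uniq : ∀ e y' p (e'' : Carrier E) → fun d₀ e'' ≡ fun d₀ e → fun d₁ e'' ≡ y'
                 → _≤_ E e e'' → e'' ≡ lift₁ e y' p
    compat     : ∀ e e' (le : _≤_ E e e') →
                 lift₁ e (fun d₁ e') (mono d₁ le) ≡ lift₀ e' (fun d₀ e) (mono d₀ le)

module _ {B ES ER : Preord} (dS₁ : Mono ES B) (dR₀ : Mono ER B) where

  CompCarrier : Set
  CompCarrier = Σ (Carrier ES × Carrier ER) (λ ef → fun dS₁ (proj₁ ef) ≡ fun dR₀ (proj₂ ef))

  Comp : Preord
  Comp = record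
    { Carrier = CompCarrier
    ; _≤_     = λ w w' → _≤_ ES (proj₁ (proj₁ w)) (proj₁ (proj₁ w'))
                       × _≤_ ER (proj₂ (proj₁ w)) (proj₂ (proj₁ w'))
    ; refl    = Preord.refl ES , Preord.refl ER
    ; trans   = λ p q → Preord.trans ES (proj₁ p) (proj₁ q) , Preord.trans ER (proj₂ p) (proj₂ q)
    }

  q₀ : CompCarrier → Carrier ES
  q₀ w = proj₁ (proj₁ w)

  q₁ : CompCarrier → Carrier ER
  q₁ w = proj₂ (proj₁ w)

module Submission where

--  * "if" holds for any commuting square of monotone maps: from e ≤ e',
--    d^S₁ e' = d^R₀ f' and f' ≤ f we get d^S₁ e ≤ d^S₁ e' = d^R₀ f' ≤ d^R₀ f
--    (lemma commuting-square-lax).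
--  * "only if" needs only condition (2) for E^S: the lift (d^S₁)_* e of
--    d^S₁ e ≤ d^R₀ f lies above e and over d^R₀ f, so paired with f itself it
--    is an element of E^S ∘ E^R with the required comparisons
--    (lemmas lift₁-witness and pullback-witness).

open import Defs
open import Data.Product using (Σ; _×_; _,_)
open import Function.Bundles using (_⇔_; mk⇔)
open import Relation.Binary.PropositionalEquality using (_≡_; subst)

mono-into : ∀ {X Y : Preord} (g : Mono X Y) {x x' : Carrier X} {b' : Carrier Y}
            → _≤_ X x x' → fun g x' ≡ b' → _≤_ Y (fun g x) b'
mono-into {Y = Y} g {b' = b'} le eq = subst (λ b → _≤_ Y (fun g _) b) eq (mono g le)

commuting-square-lax : ∀ {B E F : Preord} (u : Mono E B) (v : Mono F B)
                       {e e' : Carrier E} {f f' : Carrier F}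
                       → _≤_ E e e' → fun u e' ≡ fun v f' → _≤_ F f' f
                       → _≤_ B (fun u e) (fun v f)
commuting-square-lax {B} u v le eq lf =
  Preord.trans B (mono-into u le eq) (mono v lf)

lift₁-witness : ∀ {X Y E : Preord} {d₀ : Mono E X} {d₁ : Mono E Y}
                → IsTwoSidedDiscFib d₀ d₁
                → (e : Carrier E) (y : Carrier Y) → _≤_ Y (fun d₁ e) y
                → Σ (Carrier E) (λ e'' → _≤_ E e e'' × fun d₁ e'' ≡ y)
lift₁-witness F e y p = lift₁ e y p , lift₁-≤ e y p , lift₁-d₁ e y p
  where open IsTwoSidedDiscFib F

pullback-witness : ∀ {B C E F : Preord} {d₀ : Mono E C} {d₁ : Mono E B}
                   → IsTwoSidedDiscFib d₀ d₁ → (v : Mono F B)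
                   → (e : Carrier E) (f : Carrier F) → _≤_ B (fun d₁ e) (fun v f)
                   → Σ (CompCarrier d₁ v)
                       (λ w → _≤_ E e (q₀ d₁ v w) × _≤_ F (q₁ d₁ v w) f)
pullback-witness {F = F} S v e f p with lift₁-witness S e (fun v f) p
... | e'' , le , over = ((e'' , f) , over) , le , Preord.refl F

lemma3p6 : (A B C ES ER : Preord)
             (dS₀ : Mono ES C) (dS₁ : Mono ES B) (dR₀ : Mono ER B) (dR₁ : Mono ER A)
             → IsTwoSidedDiscFib dS₀ dS₁ → IsTwoSidedDiscFib dR₀ dR₁
             → (e : Carrier ES) (f : Carrier ER)
             → (_≤_ B (fun dS₁ e) (fun dR₀ f)
                ⇔ Σ (CompCarrier dS₁ dR₀)
                    (λ w → _≤_ ES e (q₀ dS₁ dR₀ w) × _≤_ ER (q₁ dS₁ dR₀ w) f))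
lemma3p6 A B C ES ER dS₀ dS₁ dR₀ dR₁ S _ e f =
  mk⇔ (pullback-witness S dR₀ e f)
      (λ { (((e' , f') , eq) , le , lf) → commuting-square-lax dS₁ dR₀ le eq lf })
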